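{- The following relations hold in $\Re$: (i) $A^2B-2ABA+BA^2-2AB-2BA=2A^2-2A\delta+2\alpha$; (ii) $B^2C-2BCB+CB^2-2BC-2CB=2B^2-2B\delta+2\beta$; (iii) $C^2A-2CAC+AC^2-2CA-2AC=2C^2-2C\delta+2\gamma$; (iv) $A^2C-2ACA+CA^2-2AC-2CA=2A^2-2A\delta-2\alpha$; (v) $B^2A-2BAB+AB^2-2BA-2AB=2B^2-2B\delta-2\beta$; (vi) $C^2B-2CBC+BC^2-2CB-2BC=2C^2-2C\delta-2\gamma$.
   Context: The universal Racah algebra $\Re$ is the $\mathbb C$-algebra generated by $A,B,C,\Delta$ subject to $[A,B]=[B,C]=[C,A]=2\Delta$ ($[x,y]=xy-yx$) and the requirement that each of $\alpha=[A,\Delta]+AC-BA$, $\beta=[B,\Delta]+BA-CB$, $\gamma=[C,\Delta]+CB-AC$ is central in $\Re$; $\delta=A+B+C$. -}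

module Defs where

open import Level using (suc; _⊔_)
open import Algebra.Bundles using (Ring)

-- A "Racah datum" in a ring R: elements A B C Δ satisfying the defining
-- relations of the universal Racah algebra.  The universal Racah algebra
-- (a ℂ-algebra) with its generators is one such datum; conversely any
-- relation proven for every datum holds in the universal algebra.
module RacahNotation {c ℓ} (R : Ring c ℓ) where
  open Ring R

  [_,_] : Carrier → Carrier → Carrier
  [ x , y ] = x * y - y * x

  two : Carrier
  two = 1# + 1#

  Central : Carrier → Set (c ⊔ ℓ)
  Central z = ∀ x → z * x ≈ x * z

record Racah {c ℓ} (R : Ring c ℓ) : Set (c ⊔ ℓ) where
  open Ring R
  open RacahNotation R
  field
    A B C Δ : Carrier
    AB : [ A , B ] ≈ two * Δ
    BC : [ B , C ] ≈ two * Δ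
    CA : [ C , A ] ≈ two * Δ
    α-central : Central ([ A , Δ ] + A * C - B * A)
    β-central : Central ([ B , Δ ] + B * A - C * B)
    γ-central : Central ([ C , Δ ] + C * B - A * C)

  α β γ δ : Carrier
  α = [ A , Δ ] + A * C - B * A
  β = [ B , Δ ] + B * A - C * B
  γ = [ C , Δ ] + C * B - A * C
  δ = A + B + C

-- The first three terms of each left-hand side form a double commutator, and
-- [A,[A,B]] = [A,2Δ] = 2[A,Δ]; what remains is linear bookkeeping against
-- 2A² − 2Aδ = −2AB − 2AC.  Relations (ii) and (iii) are (i) for the cyclically
-- permuted triples (B,C,A) and (C,A,B).  Relations (iv)–(vi) are (i)–(iii)
-- under the symmetry (A,B,C,Δ) ↦ (A,C,B,−Δ) of the defining relations, which
-- sends α to −α because [A,B] = [C,A].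
module Submission where

open import Defs
open import Data.Product using (_×_; _,_)
open import Algebra.Bundles using (AbelianGroup; Ring)
import Algebra.Properties.AbelianGroup as AbelianGroupProperties
import Algebra.Properties.CommutativeSemigroup as CommutativeSemigroupProperties
import Algebra.Properties.Ring as RingProperties
import Relation.Binary.Reasoning.Setoid as SetoidReasoning

module AbelianGroupIdentities {a ℓ} (G : AbelianGroup a ℓ) where
  open AbelianGroup G
  open AbelianGroupProperties G
  open CommutativeSemigroupProperties commutativeSemigroup
  open SetoidReasoning setoid

  [x-y]∙[y-z]≈x-z : ∀ x y z → (x - y) ∙ (y - z) ≈ x - z
  [x-y]∙[y-z]≈x-z x y z = begin
    (x - y) ∙ (y - z)     ≈⟨ assoc x (y ⁻¹) (y - z) ⟩
    x ∙ (y ⁻¹ ∙ (y - z))  ≈⟨ ∙-congˡ (assoc (y ⁻¹) y (z ⁻¹)) ⟨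
    x ∙ (y ⁻¹ ∙ y - z)    ≈⟨ ∙-congˡ (∙-congʳ (inverseˡ y)) ⟩
    x ∙ (ε - z)           ≈⟨ ∙-congˡ (identityˡ (z ⁻¹)) ⟩
    x - z                 ∎

  x-y≈z-w⇒x-z≈y-w : ∀ {x y z w} → x - y ≈ z - w → x - z ≈ y - w
  x-y≈z-w⇒x-z≈y-w {x} {y} {z} {w} x-y≈z-w = begin
    x - z                 ≈⟨ [x-y]∙[y-z]≈x-z x y z ⟨
    (x - y) ∙ (y - z)     ≈⟨ ∙-congʳ x-y≈z-w ⟩
    (z - w) ∙ (y - z)     ≈⟨ comm (z - w) (y - z) ⟩
    (y - z) ∙ (z - w)     ≈⟨ [x-y]∙[y-z]≈x-z y z w ⟩
    y - w                 ∎

  x-[x∙y∙z]≈[y∙z]⁻¹ : ∀ x y z → x - (x ∙ y ∙ z) ≈ (y ∙ z) ⁻¹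
  x-[x∙y∙z]≈[y∙z]⁻¹ x y z = begin
    x - (x ∙ y ∙ z)            ≈⟨ ∙-congˡ (⁻¹-cong (assoc x y z)) ⟩
    x - (x ∙ (y ∙ z))          ≈⟨ ∙-congˡ (⁻¹-∙-comm x (y ∙ z)) ⟨
    x ∙ (x ⁻¹ ∙ (y ∙ z) ⁻¹)    ≈⟨ assoc x (x ⁻¹) ((y ∙ z) ⁻¹) ⟨
    (x - x) ∙ (y ∙ z) ⁻¹       ≈⟨ ∙-congʳ (inverseʳ x) ⟩
    ε ∙ (y ∙ z) ⁻¹             ≈⟨ identityˡ ((y ∙ z) ⁻¹) ⟩
    (y ∙ z) ⁻¹                 ∎

  [x-[y∙y]]∙z≈[x-y]-[y-z] : ∀ x y z → (x - (y ∙ y)) ∙ z ≈ (x - y) - (y - z)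
  [x-[y∙y]]∙z≈[x-y]-[y-z] x y z = begin
    (x - (y ∙ y)) ∙ z           ≈⟨ xy∙z≈xz∙y x ((y ∙ y) ⁻¹) z ⟩
    x ∙ z - (y ∙ y)             ≈⟨ ∙-congˡ (⁻¹-∙-comm y y) ⟨
    x ∙ z ∙ (y ⁻¹ ∙ y ⁻¹)       ≈⟨ interchange x z (y ⁻¹) (y ⁻¹) ⟩
    (x - y) ∙ (z - y)           ≈⟨ ∙-congˡ (⁻¹-anti-homo‿- y z) ⟨
    (x - y) - (y - z)           ∎

  [x∙y]⁻¹∙[z∙y-w]≈z-x-w : ∀ x y z w → (x ∙ y) ⁻¹ ∙ (z ∙ y - w) ≈ z - x - w
  [x∙y]⁻¹∙[z∙y-w]≈z-x-w x y z w = begin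
    (x ∙ y) ⁻¹ ∙ (z ∙ y - w)
      ≈⟨ ∙-cong (⁻¹-∙-comm x y) (xy∙z≈xz∙y z (w ⁻¹) y) ⟨
    (x ⁻¹ ∙ y ⁻¹) ∙ ((z - w) ∙ y)     ≈⟨ interchange (x ⁻¹) (y ⁻¹) (z - w) y ⟩
    (x ⁻¹ ∙ (z - w)) ∙ (y ⁻¹ ∙ y)     ≈⟨ ∙-congˡ (inverseˡ y) ⟩
    (x ⁻¹ ∙ (z - w)) ∙ ε              ≈⟨ identityʳ (x ⁻¹ ∙ (z - w)) ⟩
    x ⁻¹ ∙ (z - w)                    ≈⟨ x∙yz≈yx∙z (x ⁻¹) z (w ⁻¹) ⟩
    z - x - w                         ∎

module CommutatorIdentities {c ℓ} (R : Ring c ℓ) where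
  open Ring R
  open RacahNotation R
  open RingProperties R
  open AbelianGroupIdentities +-abelianGroup
  open CommutativeSemigroupProperties +-commutativeSemigroup using (xy∙z≈xz∙y)
  open SetoidReasoning setoid

  two*x≈x+x : ∀ x → two * x ≈ x + x
  two*x≈x+x x = trans (distribʳ x 1# 1#) (+-cong (*-identityˡ x) (*-identityˡ x))

  x*two≈x+x : ∀ x → x * two ≈ x + x
  x*two≈x+x x = trans (distribˡ x 1# 1#) (+-cong (*-identityʳ x) (*-identityʳ x))

  two-central : Central two
  two-central x = trans (two*x≈x+x x) (sym (x*two≈x+x x))

  [x,y]≈-[y,x] : ∀ x y → [ x , y ] ≈ - [ y , x ]
  [x,y]≈-[y,x] x y = sym (⁻¹-anti-homo‿- (y * x) (x * y))

  [x,-y]≈-[x,y] : ∀ x y → [ x , - y ] ≈ - [ x , y ]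
  [x,-y]≈-[x,y] x y = begin
    x * - y - - y * x         ≈⟨ +-cong (-‿distribʳ-* x y) (-‿cong (-‿distribˡ-* y x)) ⟨
    - (x * y) - - (y * x)     ≈⟨ -‿+-comm (x * y) (- (y * x)) ⟩
    - [ x , y ]               ∎

  [x,k*y]≈k*[x,y] : ∀ {k} → Central k → ∀ x y → [ x , k * y ] ≈ k * [ x , y ]
  [x,k*y]≈k*[x,y] {k} k-central x y = begin
    x * (k * y) - k * y * x     ≈⟨ +-congʳ (*-assoc x k y) ⟨
    x * k * y - k * y * x       ≈⟨ +-congʳ (*-congʳ (k-central x)) ⟨
    k * x * y - k * y * x       ≈⟨ +-cong (*-assoc k x y) (-‿cong (*-assoc k y x)) ⟩
    k * (x * y) - k * (y * x)   ≈⟨ x[y-z]≈xy-xz k (x * y) (y * x) ⟨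
    k * [ x , y ]               ∎

  x²y-2xyx+yx²≈[x,[x,y]] : ∀ x y → x * x * y - two * x * y * x + y * x * x ≈ [ x , [ x , y ] ]
  x²y-2xyx+yx²≈[x,[x,y]] x y = begin
    x * x * y - two * x * y * x + y * x * x
      ≈⟨ +-congʳ (+-congˡ (-‿cong two*x*y*x≈xyx+xyx)) ⟩
    x * x * y - (x * y * x + x * y * x) + y * x * x
      ≈⟨ [x-[y∙y]]∙z≈[x-y]-[y-z] (x * x * y) (x * y * x) (y * x * x) ⟩
    (x * x * y - x * y * x) - (x * y * x - y * x * x)
      ≈⟨ +-congʳ (+-cong (*-assoc x x y) (-‿cong (*-assoc x y x))) ⟩
    (x * (x * y) - x * (y * x)) - (x * y * x - y * x * x)
      ≈⟨ +-cong (x[y-z]≈xy-xz x (x * y) (y * x)) (-‿cong ([y-z]x≈yx-zx x (x * y) (y * x))) ⟨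
    x * [ x , y ] - [ x , y ] * x
      ∎
    where
    two*x*y*x≈xyx+xyx : two * x * y * x ≈ x * y * x + x * y * x
    two*x*y*x≈xyx+xyx = begin
      two * x * y * x       ≈⟨ *-congʳ (*-assoc two x y) ⟩
      two * (x * y) * x     ≈⟨ *-assoc two (x * y) x ⟩
      two * (x * y * x)     ≈⟨ two*x≈x+x (x * y * x) ⟩
      x * y * x + x * y * x ∎

  [x,-d]+xy-zx≈-[[x,d]+xz-yx] : ∀ {x y z} d → [ x , y ] ≈ [ z , x ] →
    [ x , - d ] + x * y - z * x ≈ - ([ x , d ] + x * z - y * x)
  [x,-d]+xy-zx≈-[[x,d]+xz-yx] {x} {y} {z} d [x,y]≈[z,x] = begin
    [ x , - d ] + x * y - z * x        ≈⟨ +-assoc [ x , - d ] (x * y) (- (z * x)) ⟩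
    [ x , - d ] + (x * y - z * x)
      ≈⟨ +-cong ([x,-y]≈-[x,y] x d) (x-y≈z-w⇒x-z≈y-w [x,y]≈[z,x]) ⟩
    - [ x , d ] + (y * x - x * z)      ≈⟨ +-congˡ (⁻¹-anti-homo‿- (x * z) (y * x)) ⟨
    - [ x , d ] - (x * z - y * x)      ≈⟨ -‿+-comm [ x , d ] (x * z - y * x) ⟩
    - ([ x , d ] + (x * z - y * x))    ≈⟨ -‿cong (+-assoc [ x , d ] (x * z) (- (y * x))) ⟨
    - ([ x , d ] + x * z - y * x)      ∎

  double-commutator-relation⁺ : ∀ {x y z d s} →
    [ x , y ] ≈ two * d → s ≈ x + y + z →
    x * x * y - two * x * y * x + y * x * x - two * x * y - two * y * x
      ≈ two * x * x - two * x * s + two * ([ x , d ] + x * z - y * x)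
  double-commutator-relation⁺ {x} {y} {z} {d} {s} [x,y]≈2d s≈x+y+z = begin
    x * x * y - two * x * y * x + y * x * x - two * x * y - two * y * x
      ≈⟨ +-congʳ (+-congʳ x²y-2xyx+yx²≈2[x,d]) ⟩
    two * [ x , d ] - two * x * y - two * y * x
      ≈⟨ [x∙y]⁻¹∙[z∙y-w]≈z-x-w
           (two * x * y) (two * x * z) (two * [ x , d ]) (two * y * x) ⟨
    - (two * x * y + two * x * z) + (two * [ x , d ] + two * x * z - two * y * x)
      ≈⟨ +-cong 2x²-2xs≈-[2xy+2xz] 2α≈2[x,d]+2xz-2yx ⟨
    two * x * x - two * x * s + two * ([ x , d ] + x * z - y * x)
      ∎
    where
    x²y-2xyx+yx²≈2[x,d] : x * x * y - two * x * y * x + y * x * x ≈ two * [ x , d ]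
    x²y-2xyx+yx²≈2[x,d] = begin
      x * x * y - two * x * y * x + y * x * x  ≈⟨ x²y-2xyx+yx²≈[x,[x,y]] x y ⟩
      [ x , [ x , y ] ]
        ≈⟨ +-cong (*-congˡ [x,y]≈2d) (-‿cong (*-congʳ [x,y]≈2d)) ⟩
      [ x , two * d ]                          ≈⟨ [x,k*y]≈k*[x,y] two-central x d ⟩
      two * [ x , d ]                          ∎

    2x²-2xs≈-[2xy+2xz] : two * x * x - two * x * s ≈ - (two * x * y + two * x * z)
    2x²-2xs≈-[2xy+2xz] = begin
      two * x * x - two * x * s      ≈⟨ x[y-z]≈xy-xz (two * x) x s ⟨
      two * x * (x - s)              ≈⟨ *-congˡ x-s≈-[y+z] ⟩
      two * x * - (y + z)            ≈⟨ -‿distribʳ-* (two * x) (y + z) ⟨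
      - (two * x * (y + z))          ≈⟨ -‿cong (distribˡ (two * x) y z) ⟩
      - (two * x * y + two * x * z)  ∎
      where
      x-s≈-[y+z] : x - s ≈ - (y + z)
      x-s≈-[y+z] = trans (+-congˡ (-‿cong s≈x+y+z)) (x-[x∙y∙z]≈[y∙z]⁻¹ x y z)

    2α≈2[x,d]+2xz-2yx : two * ([ x , d ] + x * z - y * x)
                      ≈ two * [ x , d ] + two * x * z - two * y * x
    2α≈2[x,d]+2xz-2yx = begin
      two * ([ x , d ] + x * z - y * x)
        ≈⟨ x[y-z]≈xy-xz two ([ x , d ] + x * z) (y * x) ⟩
      two * ([ x , d ] + x * z) - two * (y * x)
        ≈⟨ +-cong (distribˡ two [ x , d ] (x * z)) (-‿cong (sym (*-assoc two y x))) ⟩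
      two * [ x , d ] + two * (x * z) - two * y * x
        ≈⟨ +-congʳ (+-congˡ (*-assoc two x z)) ⟨
      two * [ x , d ] + two * x * z - two * y * x
        ∎

  double-commutator-relation⁻ : ∀ {x y z d s} →
    [ z , x ] ≈ two * d → [ x , y ] ≈ two * d → s ≈ x + y + z →
    x * x * z - two * x * z * x + z * x * x - two * x * z - two * z * x
      ≈ two * x * x - two * x * s - two * ([ x , d ] + x * z - y * x)
  double-commutator-relation⁻ {x} {y} {z} {d} {s} [z,x]≈2d [x,y]≈2d s≈x+y+z = begin
    x * x * z - two * x * z * x + z * x * x - two * x * z - two * z * x
      ≈⟨ double-commutator-relation⁺ [x,z]≈2[-d] (trans s≈x+y+z (xy∙z≈xz∙y x y z)) ⟩
    two * x * x - two * x * s + two * ([ x , - d ] + x * y - z * x)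
      ≈⟨ +-congˡ 2α′≈-2α ⟩
    two * x * x - two * x * s - two * ([ x , d ] + x * z - y * x)
      ∎
    where
    [x,z]≈2[-d] : [ x , z ] ≈ two * - d
    [x,z]≈2[-d] = begin
      [ x , z ]      ≈⟨ [x,y]≈-[y,x] x z ⟩
      - [ z , x ]    ≈⟨ -‿cong [z,x]≈2d ⟩
      - (two * d)    ≈⟨ -‿distribʳ-* two d ⟩
      two * - d      ∎

    2α′≈-2α : two * ([ x , - d ] + x * y - z * x) ≈ - (two * ([ x , d ] + x * z - y * x))
    2α′≈-2α = begin
      two * ([ x , - d ] + x * y - z * x)
        ≈⟨ *-congˡ ([x,-d]+xy-zx≈-[[x,d]+xz-yx] d (trans [x,y]≈2d (sym [z,x]≈2d))) ⟩
      two * - ([ x , d ] + x * z - y * x)     ≈⟨ -‿distribʳ-* two ([ x , d ] + x * z - y * x) ⟨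
      - (two * ([ x , d ] + x * z - y * x))   ∎

lemma6p8 : ∀ {c ℓ} (R : Ring c ℓ) (𝔯 : Racah R) →
    let open Ring R
        open RacahNotation R
        open Racah 𝔯
    in (A * A * B - two * A * B * A + B * A * A - two * A * B - two * B * A
          ≈ two * A * A - two * A * δ + two * α)
     × (B * B * C - two * B * C * B + C * B * B - two * B * C - two * C * B
          ≈ two * B * B - two * B * δ + two * β)
     × (C * C * A - two * C * A * C + A * C * C - two * C * A - two * A * C
          ≈ two * C * C - two * C * δ + two * γ)
     × (A * A * C - two * A * C * A + C * A * A - two * A * C - two * C * A
          ≈ two * A * A - two * A * δ - two * α)
     × (B * B * A - two * B * A * B + A * B * B - two * B * A - two * A * B
          ≈ two * B * B - two * B * δ - two * β)
     × (C * C * B - two * C * B * C + B * C * C - two * C * B - two * B * C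
          ≈ two * C * C - two * C * δ - two * γ)
lemma6p8 R 𝔯 =
    double-commutator-relation⁺ AB δ≈A+B+C
  , double-commutator-relation⁺ BC δ≈B+C+A
  , double-commutator-relation⁺ CA δ≈C+A+B
  , double-commutator-relation⁻ CA AB δ≈A+B+C
  , double-commutator-relation⁻ AB BC δ≈B+C+A
  , double-commutator-relation⁻ BC CA δ≈C+A+B
  where
  open Ring R
  open Racah 𝔯
  open CommutatorIdentities R
  open CommutativeSemigroupProperties +-commutativeSemigroup

  δ≈A+B+C : δ ≈ A + B + C
  δ≈A+B+C = refl

  δ≈B+C+A : δ ≈ B + C + A
  δ≈B+C+A = xy∙z≈yz∙x A B C

  δ≈C+A+B : δ ≈ C + A + B
  δ≈C+A+B = xy∙z≈zx∙y A B C
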